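{- Define $a:\mathbb{Z}_{>0}\to\mathbb{Z}_{>0}$ by $a(1)=1$ and, for $n>1$, $a(n)=1+\sum_{m} a(m)$, where the sum runs over all proper divisors $m$ of $n$ (positive divisors $m$ of $n$ with $m<n$). Let $g(n)$ denote the number of ordered factorizations of $n$ into integers greater than one (i.e. the number of finite sequences $(f_1,\dots,f_r)$, $r\ge 1$, of integers $f_i>1$ with $f_1 f_2\cdots f_r=n$), and set $g(1)=1$. Then for every integer $n>1$, $$a(n)=2\,g(n).$$
   Context: $a(n)$ is called the number of recursive divisors of $n$. Equivalently, $g$ satisfies $g(1)=1$ and $g(n)=\sum_{m} g(m)$ over proper divisors $m$ of $n$ for $n>1$. -}

module Defs where

open import Data.Nat using (ℕ; zero; suc; _+_; _*_; _<_)
open import Data.Nat.Divisibility using (_∣_; _∣?_)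
open import Data.List using (List; []; _∷_; filter; map; upTo; length)
open import Data.Nat.ListAction using (sum; product)
open import Data.List.Relation.Unary.All using (All)
open import Data.Product using (Σ; _×_)
open import Relation.Binary.PropositionalEquality using (_≡_)

properDivisors : ℕ → List ℕ
properDivisors n = filter (λ m → m ∣? n) (map suc (upTo (n Data.Nat.∸ 1)))

-- a with a fuel argument; fuel n suffices since proper divisors strictly decrease.
-- For n = 1 the sum is empty, so aFuel gives 1, matching a(1) = 1.
aFuel : ℕ → ℕ → ℕ
aFuel zero    n = 1
aFuel (suc k) n = 1 + sum (map (aFuel k) (properDivisors n))

a : ℕ → ℕ
a n = aFuel n n

IsOrderedFactorization : ℕ → List ℕ → Set
IsOrderedFactorization n fs = (0 < length fs) × All (λ f → 1 < f) fs × product fs ≡ n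

{-# OPTIONS --safe #-}
module Submission where

-- Sorting the ordered factorizations (f₁, …, f_r) of n > 1 by the product d = f₂⋯f_r of
-- the tail, which ranges over the proper divisors of n (d = 1 for r = 1), gives
-- g(n) = Σ_{d proper divisor of n} g(d).  With δ(n) = [n = 1] this reads
-- g(n) = δ(n) + Σ g(d) for all n ≥ 1, and a(n) + δ(n) = 2 g(n) follows by strong
-- induction, since 1 is the only proper divisor of n ≥ 2 with δ = 1.

open import Defs
open import Data.Nat using (ℕ; zero; suc; _+_; _*_; _≤_; _<_; z<s; s<s; _∸_; _/_; >-nonZero)
open import Data.Nat.Properties
open import Data.Nat.Divisibility using (_∣_; _∣?_; divides)
open import Data.Nat.DivMod using (m/n*n≡m; m*n/n≡m)
open import Data.Nat.ListAction using (sum; product)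
open import Data.List using (List; []; _∷_; _++_; map; concatMap; filter; upTo; applyUpTo; length; drop)
open import Data.List.Properties using (filter-accept; length-++; length-map; map-cong; map-cong-local; ∷-injectiveʳ)
open import Data.List.Membership.Propositional using (_∈_; find)
open import Data.List.Membership.Propositional.Properties
open import Data.List.Relation.Unary.All as All using (All; []; _∷_)
import Data.List.Relation.Unary.All.Properties as All
open import Data.List.Relation.Unary.Any as Any using (here)
open import Data.List.Relation.Unary.AllPairs as AllPairs using ([]; _∷_)
import Data.List.Relation.Unary.AllPairs.Properties as AllPairs
open import Data.List.Relation.Unary.Unique.Propositional using (Unique)
import Data.List.Relation.Unary.Unique.Propositional.Properties as Unique
open import Data.List.Relation.Binary.Disjoint.Propositional using (Disjoint)
open import Data.Product using (Σ; _×_; _,_; proj₂)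
open import Data.Sum using (inj₁; inj₂)
open import Function using (_∘_)
open import Function.Bundles using (_⇔_; mk⇔)
open import Algebra.Properties.CommutativeSemigroup +-commutativeSemigroup using (interchange)
open import Relation.Nullary using (contradiction)
open import Relation.Binary.PropositionalEquality
  using (_≡_; _≢_; refl; sym; trans; cong; subst; module ≡-Reasoning)

private
  variable
    A B : Set
    m n : ℕ

length-concatMap : (F : A → List B) (xs : List A) →
                   length (concatMap F xs) ≡ sum (map (length ∘ F) xs)
length-concatMap F []       = refl
length-concatMap F (x ∷ xs) =
  trans (length-++ (F x)) (cong (length (F x) +_) (length-concatMap F xs))

concatMap-unique : (F : A → List B) (tag : B → A) → (∀ {x y} → y ∈ F x → tag y ≡ x) →
                   (∀ x → Unique (F x)) → {xs : List A} → Unique xs →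
                   Unique (concatMap F xs)
concatMap-unique F tag tag-F F-unique xs-unique =
  Unique.concat⁺ (All.map⁺ (All.tabulate λ {x} _ → F-unique x))
                 (AllPairs.map⁺ (AllPairs.map disjoint xs-unique))
  where
  disjoint : ∀ {x x′} → x ≢ x′ → Disjoint (F x) (F x′)
  disjoint x≢x′ (y∈Fx , y∈Fx′) = x≢x′ (trans (sym (tag-F y∈Fx)) (tag-F y∈Fx′))

sum-map-+ : (f g : A → ℕ) (xs : List A) →
            sum (map (λ x → f x + g x) xs) ≡ sum (map f xs) + sum (map g xs)
sum-map-+ f g []       = refl
sum-map-+ f g (x ∷ xs) =
  trans (cong (f x + g x +_) (sum-map-+ f g xs)) (interchange (f x) (g x) _ _)

sum-map-* : (c : ℕ) (f : A → ℕ) (xs : List A) →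
            sum (map (λ x → c * f x) xs) ≡ c * sum (map f xs)
sum-map-* c f []       = sym (*-zeroʳ c)
sum-map-* c f (x ∷ xs) =
  trans (cong (c * f x +_) (sum-map-* c f xs)) (sym (*-distribˡ-+ c (f x) _))

∈-properDivisors⁻ : ∀ n {m} → m ∈ properDivisors n → m ∣ n × 0 < m × m < n
∈-properDivisors⁻ zero {m} m∈ with ∈-filter⁻ (_∣? 0) {xs = map suc (upTo 0)} m∈
... | () , _
∈-properDivisors⁻ (suc n) {m} m∈ with ∈-filter⁻ (_∣? suc n) {xs = map suc (upTo n)} m∈
... | m∈range , m∣n with ∈-map⁻ suc m∈range
...   | i , i∈ , refl = m∣n , z<s , s<s (∈-upTo⁻ i∈)

∈-properDivisors⁺ : m ∣ n → 0 < m → m < n → m ∈ properDivisors n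
∈-properDivisors⁺ {suc i} {suc n} m∣n _ (s<s i<n) =
  ∈-filter⁺ (_∣? suc n) (∈-map⁺ suc (∈-upTo⁺ i<n)) m∣n

properDivisors-unique : (n : ℕ) → Unique (properDivisors n)
properDivisors-unique n =
  Unique.filter⁺ (_∣? n) (Unique.map⁺ suc-injective (Unique.upTo⁺ (n ∸ 1)))

properDivisors-2+ : (j : ℕ) →
  properDivisors (2 + j) ≡ 1 ∷ filter (_∣? 2 + j) (map suc (applyUpTo suc j))
properDivisors-2+ j =
  filter-accept (_∣? 2 + j) {xs = map suc (applyUpTo suc j)}
    (divides (2 + j) (sym (*-identityʳ _)))

-- Total division; the junk value n /₀ 0 = 0 is never met, as proper divisors are positive.
infixl 7 _/₀_
_/₀_ : ℕ → ℕ → ℕ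
n /₀ zero  = 0
n /₀ suc d = n / suc d

/₀*-cancel : ∀ {d n} → 0 < d → d ∣ n → n /₀ d * d ≡ n
/₀*-cancel {suc d} _ d∣n = m/n*n≡m d∣n

*/₀-cancel : ∀ {d f n} → 0 < d → f * d ≡ n → n /₀ d ≡ f
*/₀-cancel {suc d} {f} _ refl = m*n/n≡m f (suc d)

1</₀ : ∀ {d n} → 0 < d → d ∣ n → d < n → 1 < n /₀ d
1</₀ {d} {n} 0<d d∣n d<n = ≰⇒> λ q≤1 → <⇒≱ d<n (begin
  n           ≡⟨ sym (/₀*-cancel 0<d d∣n) ⟩
  n /₀ d * d  ≤⟨ *-monoˡ-≤ d q≤1 ⟩
  1 * d       ≡⟨ *-identityˡ d ⟩
  d           ∎)
  where open ≤-Reasoning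

isOne : ℕ → ℕ
isOne 1 = 1
isOne _ = 0

sum-isOne-properDivisors : (j : ℕ) → sum (map isOne (properDivisors (2 + j))) ≡ 1
sum-isOne-properDivisors j rewrite properDivisors-2+ j =
  cong suc (sum-isOne≡0
    (All.filter⁺ (_∣? 2 + j) (All.map⁺ (All.applyUpTo⁺₂ suc j λ _ → s<s z<s))))
  where
  sum-isOne≡0 : {xs : List ℕ} → All (1 <_) xs → sum (map isOne xs) ≡ 0
  sum-isOne≡0 []                 = refl
  sum-isOne≡0 (s<s (s<s _) ∷ ps) = sum-isOne≡0 ps

emptyFactorization : ℕ → List (List ℕ)
emptyFactorization 1 = [] ∷ []
emptyFactorization _ = []

∈-emptyFactorization⁻ : {fs : List ℕ} → fs ∈ emptyFactorization n → fs ≡ [] × n ≡ 1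
∈-emptyFactorization⁻ {1} (here refl) = refl , refl

emptyFactorization-unique : (n : ℕ) → Unique (emptyFactorization n)
emptyFactorization-unique 0             = []
emptyFactorization-unique 1             = [] ∷ []
emptyFactorization-unique (suc (suc _)) = []

-- The fuel k must be at least n for factorizations k n to be complete.
mutual
  factorizations : ℕ → ℕ → List (List ℕ)
  factorizations zero    n = []
  factorizations (suc k) n =
    emptyFactorization n ++ concatMap (withTailProduct k n) (properDivisors n)

  withTailProduct : ℕ → ℕ → ℕ → List (List ℕ)
  withTailProduct k n d = map (n /₀ d ∷_) (factorizations k d)

factorizations-sound : (k n : ℕ) {fs : List ℕ} → fs ∈ factorizations k n →
                       All (1 <_) fs × product fs ≡ n
factorizations-sound (suc k) n fs∈ with ∈-++⁻ (emptyFactorization n) fs∈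
... | inj₁ fs∈₀ with ∈-emptyFactorization⁻ fs∈₀
...   | refl , refl = [] , refl
factorizations-sound (suc k) n fs∈ | inj₂ fs∈blocks
  with find (∈-concatMap⁻ (withTailProduct k n) {xs = properDivisors n} fs∈blocks)
... | d , d∈ , fs∈block with ∈-map⁻ (n /₀ d ∷_) fs∈block | ∈-properDivisors⁻ n d∈
...   | gs , gs∈ , refl | d∣n , 0<d , d<n with factorizations-sound k d gs∈
...     | gs>1 , gs≡d =
  1</₀ 0<d d∣n d<n ∷ gs>1 , trans (cong (n /₀ d *_) gs≡d) (/₀*-cancel 0<d d∣n)

factorizations-unique : (k n : ℕ) → Unique (factorizations k n)
factorizations-unique zero    n = []
factorizations-unique (suc k) n =
  Unique.++⁺ (emptyFactorization-unique n) blocks-unique disjoint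
  where
  blocks-unique : Unique (concatMap (withTailProduct k n) (properDivisors n))
  blocks-unique = concatMap-unique (withTailProduct k n) (product ∘ drop 1) tail-product
    (λ d → Unique.map⁺ ∷-injectiveʳ (factorizations-unique k d)) (properDivisors-unique n)
    where
    tail-product : ∀ {d fs} → fs ∈ withTailProduct k n d → product (drop 1 fs) ≡ d
    tail-product fs∈ with ∈-map⁻ _ fs∈
    ... | gs , gs∈ , refl with factorizations-sound k _ gs∈
    ...   | _ , gs≡d = gs≡d
  disjoint : Disjoint (emptyFactorization n)
                      (concatMap (withTailProduct k n) (properDivisors n))
  disjoint (fs∈₀ , fs∈blocks) with ∈-emptyFactorization⁻ fs∈₀
  ... | refl , _ with find (∈-concatMap⁻ (withTailProduct k n) {xs = properDivisors n} fs∈blocks)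
  ...   | d , _ , fs∈block with ∈-map⁻ _ fs∈block
  ...     | _ , _ , ()

factorizations-complete : (k n : ℕ) {fs : List ℕ} → 0 < n → n ≤ k →
                          All (1 <_) fs → product fs ≡ n → fs ∈ factorizations k n
factorizations-complete zero n 0<n n≤0 _ _ = contradiction n≤0 (<⇒≱ 0<n)
factorizations-complete (suc k) n {[]} _ _ _ refl = here refl
factorizations-complete (suc k) n {f ∷ gs} 0<n n≤1+k (1<f ∷ gs>1) refl =
  ∈-++⁺ʳ (emptyFactorization n)
    (∈-concatMap⁺ (withTailProduct k n)
      (Any.map (λ { refl → f∷gs∈block }) (∈-properDivisors⁺ d∣n 0<d d<n)))
  where
  d = product gs
  0<d : 0 < d
  0<d = n≢0⇒n>0 λ d≡0 → <⇒≢ 0<n (sym (trans (cong (f *_) d≡0) (*-zeroʳ f)))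
  d<n : d < n
  d<n = subst (d <_) (*-comm d f) (m<m*n d f {{>-nonZero 0<d}} 1<f)
  d∣n : d ∣ n
  d∣n = divides f refl
  f∷gs∈block : f ∷ gs ∈ withTailProduct k n d
  f∷gs∈block = subst (λ q → q ∷ gs ∈ withTailProduct k n d) (*/₀-cancel {d} {f} {n} 0<d refl)
    (∈-map⁺ (n /₀ d ∷_)
      (factorizations-complete k d 0<d (≤-pred (≤-trans d<n n≤1+k)) gs>1 refl))

aFuel+isOne≡2*length : (k n : ℕ) → 0 < n → n ≤ k →
                       aFuel k n + isOne n ≡ 2 * length (factorizations k n)
aFuel+isOne≡2*length zero n 0<n n≤0 = contradiction n≤0 (<⇒≱ 0<n)
aFuel+isOne≡2*length (suc k) 1 _ _ = refl
aFuel+isOne≡2*length (suc k) n@(suc (suc j)) _ n≤1+k = begin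
  1 + sum (map (aFuel k) P) + 0
    ≡⟨ +-identityʳ _ ⟩
  1 + sum (map (aFuel k) P)
    ≡⟨ +-comm 1 _ ⟩
  sum (map (aFuel k) P) + 1
    ≡⟨ cong (sum (map (aFuel k) P) +_) (sym (sum-isOne-properDivisors j)) ⟩
  sum (map (aFuel k) P) + sum (map isOne P)
    ≡⟨ sym (sum-map-+ (aFuel k) isOne P) ⟩
  sum (map (λ d → aFuel k d + isOne d) P)
    ≡⟨ cong sum (map-cong-local (All.tabulate induction)) ⟩
  sum (map (λ d → 2 * length (factorizations k d)) P)
    ≡⟨ sum-map-* 2 (length ∘ factorizations k) P ⟩
  2 * sum (map (length ∘ factorizations k) P)
    ≡⟨ cong (λ s → 2 * sum s) (map-cong (λ d → sym (length-map _ (factorizations k d))) P) ⟩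
  2 * sum (map (length ∘ withTailProduct k n) P)
    ≡⟨ cong (2 *_) (sym (length-concatMap (withTailProduct k n) P)) ⟩
  2 * length (concatMap (withTailProduct k n) P) ∎
  where
  open ≡-Reasoning
  P = properDivisors n
  induction : ∀ {d} → d ∈ P → aFuel k d + isOne d ≡ 2 * length (factorizations k d)
  induction d∈ with ∈-properDivisors⁻ n d∈
  ... | _ , 0<d , d<n = aFuel+isOne≡2*length k _ 0<d (≤-pred (≤-trans d<n n≤1+k))

theorem1 : (n : ℕ) → 1 < n →
    Σ (List (List ℕ)) (λ L →
      Unique L × (∀ fs → (fs ∈ L) ⇔ IsOrderedFactorization n fs) × a n ≡ 2 * length L)
theorem1 1 (s<s ())
theorem1 n@(suc (suc _)) _ =
  factorizations n n ,
  factorizations-unique n n ,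
  (λ fs → mk⇔ (sound fs)
                (λ (_ , fs>1 , fs≡n) → factorizations-complete n n z<s ≤-refl fs>1 fs≡n)) ,
  trans (sym (+-identityʳ (a n))) (aFuel+isOne≡2*length n n z<s ≤-refl)
  where
  sound : ∀ fs → fs ∈ factorizations n n → IsOrderedFactorization n fs
  sound []      fs∈ = contradiction (proj₂ (factorizations-sound n n fs∈)) λ ()
  sound (_ ∷ _) fs∈ = z<s , factorizations-sound n n fs∈
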